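{- Let $n\ge1$ and let $\mathcal{B}_1,\mathcal{B}_2$ be non-trivial Boolean algebras. Then $\mathcal{RM}^{\mathcal{B}_1}_{C_n}$ is a subRNmatrix of $\mathcal{RM}^{\mathcal{B}_2}_{C_n}$ if and only if $\mathcal{B}_1$ is a subalgebra of $\mathcal{B}_2$.
   Context: $\Sigma$ is the signature with unary $\neg$ and binary $\wedge,\vee,\to$; formulas over $\Sigma$ are built from countably many variables. For a formula $\alpha$: $\alpha^0=\alpha$, $\alpha^{k+1}=\neg(\alpha^k\wedge\neg(\alpha^k))$; $\alpha^{(1)}=\alpha^1$, $\alpha^{(k+1)}=\alpha^{(k)}\wedge\alpha^{k+1}$. For a non-trivial Boolean algebra $\mathcal{B}$ (complement $\sim$, $a\to b=\sim a\vee b$) and $z\in|\mathcal{B}|^{n+1}$ with coordinates $z_{[i]}$: $B^{\mathcal{B}}_n=\{z: (\bigwedge_{i=1}^k z_{[i]})\vee z_{[k+1]}=1 \ \forall 1\le k\le n\}$, $D^{\mathcal{B}}_n=\{z\in B^{\mathcal{B}}_n:z_{[1]}=1\}$, $Boo^{\mathcal{B}}_n=\{z\in B^{\mathcal{B}}_n:z_{[1]}\wedge z_{[2]}=0\}$. $\mathcal{A}^{\mathcal{B}}_{C_n}$ is the $\Sigma$-multialgebra on $B^{\mathcal{B}}_n$ with $\tilde\neg z=\{w: w_{[1]}=z_{[2]}, w_{[2]}\le z_{[1]}\}$ and for $\#\in\{\wedge,\vee,\to\}$, $z\tilde\# w=\{u\in Boo^{\mathcal{B}}_n:u_{[1]}=z_{[1]}\#w_{[1]}\}$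 if $z,w\in Boo^{\mathcal{B}}_n$, else $\{u\in B^{\mathcal{B}}_n:u_{[1]}=z_{[1]}\#w_{[1]}\}$. A valuation is a map $\nu$ from formulas to $B^{\mathcal{B}}_n$ with $\nu(\neg\alpha)\in\tilde\neg\nu(\alpha)$, $\nu(\alpha\#\beta)\in\nu(\alpha)\tilde\#\nu(\beta)$. $\mathcal{F}^{\mathcal{B}}_{C_n}$ is the set of valuations such that for all $\alpha,\beta$: (1) $\nu(\alpha\wedge\neg\alpha)_{[2]}=\nu(\alpha)_{[3]}$; (2) $\nu(\alpha^1)=(\nu(\alpha)_{[3]},\nu(\alpha)_{[1]}\wedge\nu(\alpha)_{[2]},\nu(\alpha)_{[4]},\dots,\nu(\alpha)_{[n+1]},\sim\bigwedge_{i=1}^{n+1}\nu(\alpha)_{[i]})$ (for $n=1$ read $\nu(\alpha)_{[3]}$ as $\sim(\nu(\alpha)_{[1]}\wedge\nu(\alpha)_{[2]})$ and (2) as $\nu(\alpha^1)=(\sim(\nu(\alpha)_{[1]}\wedge\nu(\alpha)_{[2]}),\nu(\alpha)_{[1]}\wedge\nu(\alpha)_{[2]})$); (3) $\nu((\alpha^{(n)}\wedge\beta^{(n)})\to(\alpha\#\beta)^{(n)})\in D^{\mathcal{B}}_n$ for $\#\in\{\wedge,\vee,\to\}$. $\mathcal{RM}^{\mathcal{B}}_{C_n}$ denotes the RNmatrix $(\mathcal{A}^{\mathcal{B}}_{C_n},D^{\mathcal{B}}_n,\mathcal{F}^{\mathcal{B}}_{C_n})$. For RNmatrices $\mathcal{M}=(\mathcal{A},D,\mathcal{F})$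 and $\mathcal{M}^*=(\mathcal{A}^*,D^*,\mathcal{F}^*)$ over the same signature, $\mathcal{M}$ is a subRNmatrix of $\mathcal{M}^*$ if the universe $A$ of $\mathcal{A}$ is contained in the universe $A^*$ of $\mathcal{A}^*$ and the inclusion $j:A\to A^*$ is a homomorphism of multialgebras ($j[\sigma_{\mathcal{A}}(a_1,\dots)]\subseteq\sigma_{\mathcal{A}^*}(j(a_1),\dots)$ for every connective $\sigma$), $D\subseteq D^*$, and $j\circ\nu\in\mathcal{F}^*$ for every $\nu\in\mathcal{F}$. -}

module Defs where

open import Data.Nat using (ℕ; zero; suc)
open import Data.Fin using (Fin; toℕ) renaming (zero to fzero; suc to fsuc)
open import Data.Vec using (Vec; []; _∷_; lookup; _∷ʳ_)
open import Data.Vec.Relation.Unary.All using (All)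
open import Data.Product using (_×_)
open import Relation.Binary.PropositionalEquality using (_≡_; _≢_)

data Form : Set where
  var  : ℕ → Form
  ¬'_  : Form → Form
  _∧'_ : Form → Form → Form
  _∨'_ : Form → Form → Form
  _⇒'_ : Form → Form → Form

infix  9 ¬'_
infixr 7 _∧'_
infixr 6 _∨'_
infixr 5 _⇒'_

data BinOp : Set where
  and or imp : BinOp

app : BinOp → Form → Form → Form
app and α β = α ∧' β
app or  α β = α ∨' β
app imp α β = α ⇒' β

pow : Form → ℕ → Form
pow α zero    = α
pow α (suc k) = ¬' (pow α k ∧' ¬' (pow α k))

-- α^(k) (only meaningful for k ≥ 1; the value at 0 is an unused filler):
-- α^(1) = α^1,  α^(k+1) = α^(k) ∧ α^(k+1)
paren : Form → ℕ → Form
paren α zero          = α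
paren α (suc zero)    = pow α 1
paren α (suc (suc k)) = paren α (suc k) ∧' pow α (suc (suc k))

-- Boolean algebras whose universe is a subset of an ambient type U,
-- so that "subset" / "subalgebra" is literal inclusion.

record BoolAlg (U : Set) : Set₁ where
  infixr 7 _∧_
  infixr 6 _∨_
  field
    Car : U → Set
    _∧_ _∨_ : U → U → U
    ∼ : U → U
    𝟘 𝟙 : U
    𝟘∈ : Car 𝟘
    𝟙∈ : Car 𝟙
    ∧∈ : ∀ {x y} → Car x → Car y → Car (x ∧ y)
    ∨∈ : ∀ {x y} → Car x → Car y → Car (x ∨ y)
    ∼∈ : ∀ {x} → Car x → Car (∼ x)
    ∧-comm  : ∀ {x y} → Car x → Car y → x ∧ y ≡ y ∧ x
    ∨-comm  : ∀ {x y} → Car x → Car y → x ∨ y ≡ y ∨ x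
    ∧-assoc : ∀ {x y z} → Car x → Car y → Car z → (x ∧ y) ∧ z ≡ x ∧ (y ∧ z)
    ∨-assoc : ∀ {x y z} → Car x → Car y → Car z → (x ∨ y) ∨ z ≡ x ∨ (y ∨ z)
    ∧-absorb : ∀ {x y} → Car x → Car y → x ∧ (x ∨ y) ≡ x
    ∨-absorb : ∀ {x y} → Car x → Car y → x ∨ (x ∧ y) ≡ x
    ∧-distrib-∨ : ∀ {x y z} → Car x → Car y → Car z → x ∧ (y ∨ z) ≡ (x ∧ y) ∨ (x ∧ z)
    ∧-identity : ∀ {x} → Car x → x ∧ 𝟙 ≡ x
    ∨-identity : ∀ {x} → Car x → x ∨ 𝟘 ≡ x
    ∧-compl : ∀ {x} → Car x → x ∧ ∼ x ≡ 𝟘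
    ∨-compl : ∀ {x} → Car x → x ∨ ∼ x ≡ 𝟙

NonTrivial : ∀ {U} → BoolAlg U → Set
NonTrivial B = BoolAlg.𝟘 B ≢ BoolAlg.𝟙 B

Subalgebra : ∀ {U} → BoolAlg U → BoolAlg U → Set
Subalgebra {U} B₁ B₂ =
    (∀ x → Car₁ x → Car₂ x)
  × (∀ x y → Car₁ x → Car₁ y → x ∧₁ y ≡ x ∧₂ y)
  × (∀ x y → Car₁ x → Car₁ y → x ∨₁ y ≡ x ∨₂ y)
  × (∀ x → Car₁ x → ∼₁ x ≡ ∼₂ x)
  × (𝟘₁ ≡ 𝟘₂)
  × (𝟙₁ ≡ 𝟙₂)
  where
  open BoolAlg B₁ renaming (Car to Car₁; _∧_ to _∧₁_; _∨_ to _∨₁_; ∼ to ∼₁; 𝟘 to 𝟘₁; 𝟙 to 𝟙₁)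
  open BoolAlg B₂ renaming (Car to Car₂; _∧_ to _∧₂_; _∨_ to _∨₂_; ∼ to ∼₂; 𝟘 to 𝟘₂; 𝟙 to 𝟙₂)

record RNmatrix (T : Set) : Set₁ where
  field
    Univ : T → Set
    negM : T → T → Set                   -- negM z w  :  w ∈ ¬̃ z
    binM : BinOp → T → T → T → Set       -- binM # z w u  :  u ∈ z #̃ w
    Des  : T → Set
    Val  : (Form → T) → Set

-- M is a subRNmatrix of M* (inclusion j is the identity on T)
SubRN : ∀ {T} → RNmatrix T → RNmatrix T → Set
SubRN M M* =
    (∀ x → M.Univ x → M*.Univ x)
  × (∀ z → M.Univ z → ∀ w → M.negM z w → M*.negM z w)
  × (∀ o z w → M.Univ z → M.Univ w → ∀ u → M.binM o z w u → M*.binM o z w u)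
  × (∀ x → M.Des x → M*.Des x)
  × (∀ ν → M.Val ν → M*.Val ν)
  where
  module M  = RNmatrix M
  module M* = RNmatrix M*

-- The RNmatrix RM^B_{C_n} on tuples z ∈ U^{n+1} (Vec U (suc n));
-- z_[1] is lookup z 0, etc.

module RMC {U : Set} (B : BoolAlg U) (n : ℕ) where
  open BoolAlg B

  Tup : Set
  Tup = Vec U (suc n)

  bigMeet : ∀ {m} → Vec U m → U
  bigMeet []       = 𝟙
  bigMeet (x ∷ xs) = x ∧ bigMeet xs

  meetUpTo : ∀ {m} → Vec U m → ℕ → U
  meetUpTo []       k       = 𝟙
  meetUpTo (x ∷ xs) zero    = 𝟙
  meetUpTo (x ∷ xs) (suc k) = x ∧ meetUpTo xs k

  c1 : Tup → U
  c1 (a ∷ _) = a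

  c2 : Tup → U
  c2 (a ∷ [])    = a          -- unused filler (n = 0)
  c2 (a ∷ b ∷ _) = b

  -- z_[3]; for n = 1 read as ∼(z_[1] ∧ z_[2])
  c3 : Tup → U
  c3 (a ∷ [])        = a      -- unused filler (n = 0)
  c3 (a ∷ b ∷ [])    = ∼ (a ∧ b)
  c3 (a ∷ b ∷ c ∷ _) = c

  -- the prescribed value of ν(α¹) from ν(α)
  tick : Tup → Tup
  tick (a ∷ [])           = a ∷ []   -- unused filler (n = 0)
  tick (a ∷ b ∷ [])       = ∼ (a ∧ b) ∷ (a ∧ b) ∷ []
  tick (a ∷ b ∷ c ∷ rest) = c ∷ (a ∧ b) ∷ (rest ∷ʳ ∼ (bigMeet (a ∷ b ∷ c ∷ rest)))

  _≤_ : U → U → Set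
  x ≤ y = x ∧ y ≡ x

  op : BinOp → U → U → U
  op and x y = x ∧ y
  op or  x y = x ∨ y
  op imp x y = ∼ x ∨ y

  InB : Tup → Set
  InB z = All Car z
        × (∀ (k : Fin n) → meetUpTo z (suc (toℕ k)) ∨ lookup z (fsuc k) ≡ 𝟙)

  InD : Tup → Set
  InD z = InB z × c1 z ≡ 𝟙

  InBoo : Tup → Set
  InBoo z = InB z × c1 z ∧ c2 z ≡ 𝟘

  negM : Tup → Tup → Set
  negM z w = InB w × c1 w ≡ c2 z × c2 w ≤ c1 z

  binM : BinOp → Tup → Tup → Tup → Set
  binM o z w u = InB u × c1 u ≡ op o (c1 z) (c1 w) × (InBoo z → InBoo w → InBoo u)

  IsValuation : (Form → Tup) → Set
  IsValuation ν = (∀ α → InB (ν α))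
                × (∀ α → negM (ν α) (ν (¬' α)))
                × (∀ o α β → binM o (ν α) (ν β) (ν (app o α β)))

  InF : (Form → Tup) → Set
  InF ν = IsValuation ν
        × (∀ α → c2 (ν (α ∧' ¬' α)) ≡ c3 (ν α))
        × (∀ α → ν (pow α 1) ≡ tick (ν α))
        × (∀ o α β → InD (ν ((paren α n ∧' paren β n) ⇒' paren (app o α β) n)))

  RM : RNmatrix Tup
  RM = record { Univ = InB ; negM = negM ; binM = binM ; Des = InD ; Val = InF }

-- If B₁ is a subalgebra of B₂, every clause defining RM^B_{C_n} is built from the
-- Boolean operations, so on tuples over B₁ the clauses for B₁ and for B₂ coincide.
--
-- Conversely, let RM^{B₁} be a subRNmatrix of RM^{B₂}. The tuple (x, 𝟙, …, 𝟙) gives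
-- |B₁| ⊆ |B₂|, the designated tuple (𝟙, 𝟘, 𝟙, …, 𝟙) gives 𝟙₁ = 𝟙₂, and the
-- multioperations at (a, ∼₁ a, 𝟙, …, 𝟙) with a = x #₁ y give x #₁ y = x #₂ y for
-- # ∈ {∧, ∨, →}. These equations cannot distinguish 𝟘₁ from 𝟘₂; the complement is
-- pinned down by the two-valued valuation, which lies in F^{B₁} and hence in F^{B₂}:
-- clause (2) at a variable forces ∼₂ 𝟘₁ = 𝟙₂, so 𝟘₁ = 𝟘₁ ∧₂ ∼₂ 𝟘₁ = 𝟘₂, and then
-- ∼₁ x = x →₁ 𝟘₁ = x →₂ 𝟘₂ = ∼₂ x.
{-# OPTIONS --safe #-}
module Submission where

open import Defs
open import Data.Bool using (Bool; true; false; not) renaming (_∧_ to _&&_; _∨_ to _||_)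
import Data.Bool.Properties as Bool
open import Data.Fin using (Fin; toℕ) renaming (zero to fzero; suc to fsuc)
open import Data.Nat using (ℕ; _≤_; zero; suc)
open import Data.Product using (_×_; _,_; proj₁; proj₂)
open import Data.Vec using (Vec; []; _∷_; lookup; _∷ʳ_; replicate)
open import Data.Vec.Properties using (∷-injective; ∷ʳ-injectiveʳ; lookup-replicate)
open import Data.Vec.Relation.Unary.All as All using (All; []; _∷_)
open import Data.Vec.Relation.Unary.All.Properties using (lookup⁺)
open import Function.Base using (_∘_)
open import Function.Bundles using (_⇔_; mk⇔; Equivalence)
open import Relation.Binary.PropositionalEquality
open ≡-Reasoning

replicate-∷ʳ : ∀ {A : Set} m (x : A) → replicate m x ∷ʳ x ≡ x ∷ replicate m x
replicate-∷ʳ zero    x = refl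
replicate-∷ʳ (suc m) x = cong (x ∷_) (replicate-∷ʳ m x)

module BoolAlgProperties {U : Set} (B : BoolAlg U) where
  open BoolAlg B
  -- meetUpTo, bigMeet and op do not depend on n
  open RMC B 0 using (meetUpTo; bigMeet; op)

  ∧-identityˡ : ∀ {x} → Car x → 𝟙 ∧ x ≡ x
  ∧-identityˡ x∈ = trans (∧-comm 𝟙∈ x∈) (∧-identity x∈)

  ∨-identityˡ : ∀ {x} → Car x → 𝟘 ∨ x ≡ x
  ∨-identityˡ x∈ = trans (∨-comm 𝟘∈ x∈) (∨-identity x∈)

  ∨-zeroˡ : ∀ {x} → Car x → 𝟙 ∨ x ≡ 𝟙
  ∨-zeroˡ x∈ = trans (sym (∧-identityˡ (∨∈ 𝟙∈ x∈))) (∧-absorb 𝟙∈ x∈)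

  ∨-zeroʳ : ∀ {x} → Car x → x ∨ 𝟙 ≡ 𝟙
  ∨-zeroʳ x∈ = trans (∨-comm x∈ 𝟙∈) (∨-zeroˡ x∈)

  ∧-zeroˡ : ∀ {x} → Car x → 𝟘 ∧ x ≡ 𝟘
  ∧-zeroˡ x∈ = trans (sym (∨-identityˡ (∧∈ 𝟘∈ x∈))) (∨-absorb 𝟘∈ x∈)

  ∼𝟙≡𝟘 : ∼ 𝟙 ≡ 𝟘
  ∼𝟙≡𝟘 = trans (sym (∧-identityˡ (∼∈ 𝟙∈))) (∧-compl 𝟙∈)

  ∼𝟘≡𝟙 : ∼ 𝟘 ≡ 𝟙
  ∼𝟘≡𝟙 = trans (sym (∨-identityˡ (∼∈ 𝟘∈))) (∨-compl 𝟘∈)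

  op∈ : ∀ o {x y} → Car x → Car y → Car (op o x y)
  op∈ and x∈ y∈ = ∧∈ x∈ y∈
  op∈ or  x∈ y∈ = ∨∈ x∈ y∈
  op∈ imp x∈ y∈ = ∨∈ (∼∈ x∈) y∈

  replicate-𝟙∈ : ∀ m → All Car (replicate m 𝟙)
  replicate-𝟙∈ zero    = []
  replicate-𝟙∈ (suc m) = 𝟙∈ ∷ replicate-𝟙∈ m

  meetUpTo∈ : ∀ {m} {z : Vec U m} → All Car z → ∀ k → Car (meetUpTo z k)
  meetUpTo∈ []          k       = 𝟙∈
  meetUpTo∈ (_ ∷ _)     zero    = 𝟙∈
  meetUpTo∈ (x∈ ∷ xs∈) (suc k) = ∧∈ x∈ (meetUpTo∈ xs∈ k)

  bigMeet∈ : ∀ {m} {z : Vec U m} → All Car z → Car (bigMeet z)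
  bigMeet∈ []          = 𝟙∈
  bigMeet∈ (x∈ ∷ xs∈) = ∧∈ x∈ (bigMeet∈ xs∈)

  bigMeet-replicate-𝟙 : ∀ m → bigMeet (replicate m 𝟙) ≡ 𝟙
  bigMeet-replicate-𝟙 zero    = refl
  bigMeet-replicate-𝟙 (suc m) = trans (cong (𝟙 ∧_) (bigMeet-replicate-𝟙 m)) (∧-identity 𝟙∈)

module Padded {U : Set} (B : BoolAlg U) where
  open BoolAlg B
  open BoolAlgProperties B
  open RMC B 0 using (meetUpTo; bigMeet)

  pad : ∀ {m} → U → U → Vec U (suc (suc m))
  pad {m} a b = a ∷ b ∷ replicate m 𝟙

  pad-InB : ∀ {m a b} → Car a → Car b → a ∨ b ≡ 𝟙 → RMC.InB B (suc m) (pad a b)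
  pad-InB {m} {a} {b} a∈ b∈ a∨b≡𝟙 = pad∈ , cover
    where
    pad∈ : All Car (pad {m} a b)
    pad∈ = a∈ ∷ b∈ ∷ replicate-𝟙∈ m

    cover : ∀ (k : Fin (suc m)) → meetUpTo (pad {m} a b) (suc (toℕ k)) ∨ lookup (pad {m} a b) (fsuc k) ≡ 𝟙
    cover fzero    = trans (cong (_∨ b) (∧-identity a∈)) a∨b≡𝟙
    cover (fsuc k) = trans (cong (meetUpTo (pad {m} a b) (suc (suc (toℕ k))) ∨_) (lookup-replicate k 𝟙))
                           (∨-zeroʳ (meetUpTo∈ pad∈ (suc (suc (toℕ k)))))

  bigMeet-pad : ∀ {m a b} → Car b → bigMeet (pad {m} a b) ≡ a ∧ b
  bigMeet-pad {m} {a} {b} b∈ = cong (a ∧_) (trans (cong (b ∧_) (bigMeet-replicate-𝟙 m)) (∧-identity b∈))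

  c3-pad : ∀ {m a b} → a ∧ b ≡ 𝟘 → RMC.c3 B (suc m) (pad a b) ≡ 𝟙
  c3-pad {zero}  a∧b≡𝟘 = trans (cong ∼ a∧b≡𝟘) ∼𝟘≡𝟙
  c3-pad {suc m} _     = refl

  tick-pad : ∀ {m a b c} → Car b →
             RMC.tick B (suc m) (pad a b) ≡ pad 𝟙 c ⇔ (a ∧ b ≡ c × ∼ (a ∧ b) ≡ 𝟙)
  tick-pad {zero} {a} {b} {c} _ = mk⇔ to from
    where
    to : ∼ (a ∧ b) ∷ (a ∧ b) ∷ [] ≡ 𝟙 ∷ c ∷ [] → a ∧ b ≡ c × ∼ (a ∧ b) ≡ 𝟙
    to eq = proj₁ (∷-injective (proj₂ (∷-injective eq))) , proj₁ (∷-injective eq)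

    from : a ∧ b ≡ c × ∼ (a ∧ b) ≡ 𝟙 → ∼ (a ∧ b) ∷ (a ∧ b) ∷ [] ≡ 𝟙 ∷ c ∷ []
    from (ab≡c , ∼ab≡𝟙) = cong₂ (λ x y → x ∷ y ∷ []) ∼ab≡𝟙 ab≡c
  tick-pad {suc m} {a} {b} {c} b∈ = mk⇔ to from
    where
    last≡𝟙 : ∀ {x} → replicate m 𝟙 ∷ʳ x ≡ 𝟙 ∷ replicate m 𝟙 → x ≡ 𝟙
    last≡𝟙 eq = ∷ʳ-injectiveʳ (replicate m 𝟙) (replicate m 𝟙) (trans eq (sym (replicate-∷ʳ m 𝟙)))

    to : RMC.tick B (suc (suc m)) (pad a b) ≡ pad 𝟙 c → a ∧ b ≡ c × ∼ (a ∧ b) ≡ 𝟙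
    to eq = let (ab≡c , tail≡) = ∷-injective (proj₂ (∷-injective eq))
            in ab≡c , trans (cong ∼ (sym (bigMeet-pad {suc m} b∈))) (last≡𝟙 tail≡)

    from : a ∧ b ≡ c × ∼ (a ∧ b) ≡ 𝟙 → RMC.tick B (suc (suc m)) (pad a b) ≡ pad 𝟙 c
    from (ab≡c , ∼ab≡𝟙) = cong₂ (λ x y → 𝟙 ∷ x ∷ y) ab≡c (begin
      replicate m 𝟙 ∷ʳ ∼ (bigMeet (pad {suc m} a b)) ≡⟨ cong (λ t → replicate m 𝟙 ∷ʳ ∼ t) (bigMeet-pad {suc m} b∈) ⟩
      replicate m 𝟙 ∷ʳ ∼ (a ∧ b)                     ≡⟨ cong (replicate m 𝟙 ∷ʳ_) ∼ab≡𝟙 ⟩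
      replicate m 𝟙 ∷ʳ 𝟙                             ≡⟨ replicate-∷ʳ m 𝟙 ⟩
      𝟙 ∷ replicate m 𝟙                              ∎)

module Classical {U : Set} (B : BoolAlg U) (m : ℕ) where
  open BoolAlg B
  open BoolAlgProperties B
  open Padded B
  open RMC B (suc m)

  ⌜_⌝ : Bool → U
  ⌜ true  ⌝ = 𝟙
  ⌜ false ⌝ = 𝟘

  ⌜⌝∈ : ∀ b → Car ⌜ b ⌝
  ⌜⌝∈ true  = 𝟙∈
  ⌜⌝∈ false = 𝟘∈

  ⌜⌝-&& : ∀ b c → ⌜ b && c ⌝ ≡ ⌜ b ⌝ ∧ ⌜ c ⌝
  ⌜⌝-&& true  c = sym (∧-identityˡ (⌜⌝∈ c))
  ⌜⌝-&& false c = sym (∧-zeroˡ (⌜⌝∈ c))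

  ⌜⌝-|| : ∀ b c → ⌜ b || c ⌝ ≡ ⌜ b ⌝ ∨ ⌜ c ⌝
  ⌜⌝-|| true  c = sym (∨-zeroˡ (⌜⌝∈ c))
  ⌜⌝-|| false c = sym (∨-identityˡ (⌜⌝∈ c))

  ⌜⌝-not : ∀ b → ⌜ not b ⌝ ≡ ∼ ⌜ b ⌝
  ⌜⌝-not true  = sym ∼𝟙≡𝟘
  ⌜⌝-not false = sym ∼𝟘≡𝟙

  ⌜⌝-disjoint : ∀ b → ⌜ b ⌝ ∧ ⌜ not b ⌝ ≡ 𝟘
  ⌜⌝-disjoint b = trans (sym (⌜⌝-&& b (not b))) (cong ⌜_⌝ (Bool.∧-inverseʳ b))

  ⌜⌝-cover : ∀ b → ⌜ b ⌝ ∨ ⌜ not b ⌝ ≡ 𝟙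
  ⌜⌝-cover b = trans (sym (⌜⌝-|| b (not b))) (cong ⌜_⌝ (Bool.∨-inverseʳ b))

  ev : Form → Bool
  ev (var _)  = false
  ev (¬' φ)   = not (ev φ)
  ev (φ ∧' ψ) = ev φ && ev ψ
  ev (φ ∨' ψ) = ev φ || ev ψ
  ev (φ ⇒' ψ) = not (ev φ) || ev ψ

  ⟦_⟧ : Bool → Tup
  ⟦ b ⟧ = pad ⌜ b ⌝ ⌜ not b ⌝

  ν : Form → Tup
  ν = ⟦_⟧ ∘ ev

  ⟦⟧-InBoo : ∀ b → InBoo ⟦ b ⟧
  ⟦⟧-InBoo b = pad-InB (⌜⌝∈ b) (⌜⌝∈ (not b)) (⌜⌝-cover b) , ⌜⌝-disjoint b

  ⟦⟧-InB : ∀ b → InB ⟦ b ⟧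
  ⟦⟧-InB b = proj₁ (⟦⟧-InBoo b)

  ⟦⟧-negM : ∀ b → negM ⟦ b ⟧ ⟦ not b ⟧
  ⟦⟧-negM true  = ⟦⟧-InB false , refl , ∧-identity 𝟙∈
  ⟦⟧-negM false = ⟦⟧-InB true  , refl , ∧-zeroˡ 𝟘∈

  tick-⟦⟧ : ∀ b → tick ⟦ b ⟧ ≡ ⟦ true ⟧
  tick-⟦⟧ b = Equivalence.from (tick-pad (⌜⌝∈ (not b)))
    (⌜⌝-disjoint b , trans (cong ∼ (⌜⌝-disjoint b)) ∼𝟘≡𝟙)

  ⌜⌝-app : ∀ o α β → ⌜ ev (app o α β) ⌝ ≡ op o ⌜ ev α ⌝ ⌜ ev β ⌝
  ⌜⌝-app and α β = ⌜⌝-&& (ev α) (ev β)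
  ⌜⌝-app or  α β = ⌜⌝-|| (ev α) (ev β)
  ⌜⌝-app imp α β = trans (⌜⌝-|| (not (ev α)) (ev β)) (cong (_∨ ⌜ ev β ⌝) (⌜⌝-not (ev α)))

  ν-binM : ∀ o α β → binM o (ν α) (ν β) (ν (app o α β))
  ν-binM o α β = ⟦⟧-InB (ev (app o α β)) , ⌜⌝-app o α β , λ _ _ → ⟦⟧-InBoo (ev (app o α β))

  ev-pow : ∀ α k → ev (pow α (suc k)) ≡ true
  ev-pow α k = cong not (Bool.∧-inverseʳ (ev (pow α k)))

  ev-paren : ∀ α k → ev (paren α (suc k)) ≡ true
  ev-paren α zero    = ev-pow α 0
  ev-paren α (suc k) = cong₂ _&&_ (ev-paren α k) (ev-pow α (suc k))

  ev-paren-⇒ : ∀ o α β → ev ((paren α (suc m) ∧' paren β (suc m)) ⇒' paren (app o α β) (suc m)) ≡ true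
  ev-paren-⇒ o α β = trans (cong (_ ||_) (ev-paren (app o α β) m)) (Bool.∨-zeroʳ _)

  ν∈F : InF ν
  ν∈F = ((λ α → ⟦⟧-InB (ev α)) , (λ α → ⟦⟧-negM (ev α)) , ν-binM)
      , (λ α → trans (cong ⌜_⌝ (ev-pow α 0)) (sym (c3-pad {m} (⌜⌝-disjoint (ev α)))))
      , (λ α → trans (cong ⟦_⟧ (ev-pow α 0)) (sym (tick-⟦⟧ (ev α))))
      , (λ o α β → subst (InD ∘ ⟦_⟧) (sym (ev-paren-⇒ o α β)) (⟦⟧-InB true , refl))

module _ {U : Set} {B₁ B₂ : BoolAlg U} where
  open BoolAlg B₁ using () renaming (Car to Car₁; _∧_ to _∧₁_; _∨_ to _∨₁_; ∼ to ∼₁; 𝟘 to 𝟘₁; 𝟙 to 𝟙₁)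
  open BoolAlg B₂ using () renaming (Car to Car₂; _∧_ to _∧₂_; _∨_ to _∨₂_; ∼ to ∼₂; 𝟘 to 𝟘₂; 𝟙 to 𝟙₂)
  private
    module B₁ = BoolAlg B₁
    module B₂ = BoolAlg B₂
    module P₁ = Padded B₁
    module P₂ = Padded B₂

  module _ {m : ℕ} where
    private
      module R₁ = RMC B₁ (suc m)
      module R₂ = RMC B₂ (suc m)

    Univ⊆⇒Car⊆ : (∀ z → R₁.InB z → R₂.InB z) → ∀ x → Car₁ x → Car₂ x
    Univ⊆⇒Car⊆ univ x x∈ =
      All.head (proj₁ (univ (P₁.pad x 𝟙₁) (P₁.pad-InB x∈ B₁.𝟙∈ (BoolAlgProperties.∨-zeroʳ B₁ x∈))))

    Des⊆⇒𝟙≡𝟙 : (∀ z → R₁.InD z → R₂.InD z) → 𝟙₁ ≡ 𝟙₂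
    Des⊆⇒𝟙≡𝟙 des = proj₂ (des (P₁.pad 𝟙₁ 𝟘₁) (P₁.pad-InB B₁.𝟙∈ B₁.𝟘∈ (B₁.∨-identity B₁.𝟙∈) , refl))

    binM⊆⇒op≡op : (∀ o z w → R₁.InB z → R₁.InB w → ∀ u → R₁.binM o z w u → R₂.binM o z w u)
                → ∀ o {x y} → Car₁ x → Car₁ y → R₁.op o x y ≡ R₂.op o x y
    binM⊆⇒op≡op bin o {x} {y} x∈ y∈ =
      proj₁ (proj₂ (bin o (P₁.pad x 𝟙₁) (P₁.pad y 𝟙₁) (top x∈) (top y∈) (P₁.pad a (∼₁ a))
                        (a∼a-InB , refl , λ _ _ → a∼a-InB , B₁.∧-compl a∈)))
      where
      top : ∀ {x} → Car₁ x → R₁.InB (P₁.pad x 𝟙₁)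
      top x∈ = P₁.pad-InB x∈ B₁.𝟙∈ (BoolAlgProperties.∨-zeroʳ B₁ x∈)

      a : U
      a = R₁.op o x y

      a∈ : Car₁ a
      a∈ = BoolAlgProperties.op∈ B₁ o x∈ y∈

      a∼a-InB : R₁.InB (P₁.pad a (∼₁ a))
      a∼a-InB = P₁.pad-InB a∈ (B₁.∼∈ a∈) (B₁.∨-compl a∈)

    Val⊆⇒∼𝟘≡𝟙 : 𝟙₁ ≡ 𝟙₂ → (∀ ν → R₁.InF ν → R₂.InF ν) → ∼₂ 𝟘₁ ≡ 𝟙₂
    Val⊆⇒∼𝟘≡𝟙 𝟙≡𝟙 val =
      let (𝟘₁∧𝟙≡𝟘₁ , ∼[𝟘₁∧𝟙]≡𝟙) = Equivalence.to (P₂.tick-pad B₂.𝟙∈) (sym tick-var)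
      in subst (λ t → ∼₂ t ≡ 𝟙₂) 𝟘₁∧𝟙≡𝟘₁ ∼[𝟘₁∧𝟙]≡𝟙
      where
      open Classical B₁ m using (ν; ν∈F)

      tick-var : P₂.pad 𝟙₂ 𝟘₁ ≡ R₂.tick (P₂.pad 𝟘₁ 𝟙₂)
      tick-var = subst (λ e → e ∷ 𝟘₁ ∷ replicate m e ≡ R₂.tick (𝟘₁ ∷ e ∷ replicate m e)) 𝟙≡𝟙
                       (proj₁ (proj₂ (proj₂ (val ν ν∈F))) (var 0))

    subRN⇒subalgebra : SubRN (RMC.RM B₁ (suc m)) (RMC.RM B₂ (suc m)) → Subalgebra B₁ B₂
    subRN⇒subalgebra (univ , _ , bin , des , val) = ⊆ , ∧≡∧ , ∨≡∨ , ∼≡∼ , 𝟘≡𝟘 , 𝟙≡𝟙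
      where
      ⊆ : ∀ x → Car₁ x → Car₂ x
      ⊆ = Univ⊆⇒Car⊆ univ

      𝟙≡𝟙 : 𝟙₁ ≡ 𝟙₂
      𝟙≡𝟙 = Des⊆⇒𝟙≡𝟙 des

      ∧≡∧ : ∀ x y → Car₁ x → Car₁ y → x ∧₁ y ≡ x ∧₂ y
      ∧≡∧ _ _ = binM⊆⇒op≡op bin and

      ∨≡∨ : ∀ x y → Car₁ x → Car₁ y → x ∨₁ y ≡ x ∨₂ y
      ∨≡∨ _ _ = binM⊆⇒op≡op bin or

      𝟘≡𝟘 : 𝟘₁ ≡ 𝟘₂
      𝟘≡𝟘 = begin
        𝟘₁           ≡⟨ sym (B₂.∧-identity (⊆ _ B₁.𝟘∈)) ⟩
        𝟘₁ ∧₂ 𝟙₂     ≡⟨ cong (𝟘₁ ∧₂_) (sym (Val⊆⇒∼𝟘≡𝟙 𝟙≡𝟙 val)) ⟩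
        𝟘₁ ∧₂ ∼₂ 𝟘₁  ≡⟨ B₂.∧-compl (⊆ _ B₁.𝟘∈) ⟩
        𝟘₂           ∎

      ∼≡∼ : ∀ x → Car₁ x → ∼₁ x ≡ ∼₂ x
      ∼≡∼ x x∈ = begin
        ∼₁ x         ≡⟨ sym (B₁.∨-identity (B₁.∼∈ x∈)) ⟩
        ∼₁ x ∨₁ 𝟘₁   ≡⟨ binM⊆⇒op≡op bin imp x∈ B₁.𝟘∈ ⟩
        ∼₂ x ∨₂ 𝟘₁   ≡⟨ cong (∼₂ x ∨₂_) 𝟘≡𝟘 ⟩
        ∼₂ x ∨₂ 𝟘₂   ≡⟨ B₂.∨-identity (B₂.∼∈ (⊆ x x∈)) ⟩
        ∼₂ x         ∎

  module _ {n : ℕ}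
    (⊆ : ∀ x → Car₁ x → Car₂ x)
    (∧≡∧ : ∀ x y → Car₁ x → Car₁ y → x ∧₁ y ≡ x ∧₂ y)
    (∨≡∨ : ∀ x y → Car₁ x → Car₁ y → x ∨₁ y ≡ x ∨₂ y)
    (∼≡∼ : ∀ x → Car₁ x → ∼₁ x ≡ ∼₂ x)
    (𝟘≡𝟘 : 𝟘₁ ≡ 𝟘₂)
    (𝟙≡𝟙 : 𝟙₁ ≡ 𝟙₂)
    where
    private
      module R₁ = RMC B₁ n
      module R₂ = RMC B₂ n
      open BoolAlgProperties B₁ using (meetUpTo∈; bigMeet∈)

    meetUpTo-agree : ∀ {k} {z : Vec U k} → All Car₁ z → ∀ i → R₁.meetUpTo z i ≡ R₂.meetUpTo z i
    meetUpTo-agree []         _       = 𝟙≡𝟙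
    meetUpTo-agree (_ ∷ _)    zero    = 𝟙≡𝟙
    meetUpTo-agree (x∈ ∷ xs∈) (suc i) =
      trans (∧≡∧ _ _ x∈ (meetUpTo∈ xs∈ i)) (cong (_ ∧₂_) (meetUpTo-agree xs∈ i))

    bigMeet-agree : ∀ {k} {z : Vec U k} → All Car₁ z → R₁.bigMeet z ≡ R₂.bigMeet z
    bigMeet-agree []         = 𝟙≡𝟙
    bigMeet-agree (x∈ ∷ xs∈) = trans (∧≡∧ _ _ x∈ (bigMeet∈ xs∈)) (cong (_ ∧₂_) (bigMeet-agree xs∈))

    c1∈ : ∀ {z} → All Car₁ z → Car₁ (R₁.c1 z)
    c1∈ (a∈ ∷ _) = a∈

    c2∈ : ∀ {z} → All Car₁ z → Car₁ (R₁.c2 z)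
    c2∈ (a∈ ∷ [])    = a∈
    c2∈ (_ ∷ b∈ ∷ _) = b∈

    c1-agree : ∀ z → R₁.c1 z ≡ R₂.c1 z
    c1-agree (_ ∷ _) = refl

    c2-agree : ∀ z → R₁.c2 z ≡ R₂.c2 z
    c2-agree (_ ∷ [])    = refl
    c2-agree (_ ∷ _ ∷ _) = refl

    c1∧c2-agree : ∀ {z} → All Car₁ z → R₁.c1 z ∧₁ R₁.c2 z ≡ R₂.c1 z ∧₂ R₂.c2 z
    c1∧c2-agree {z} z∈ = trans (∧≡∧ _ _ (c1∈ z∈) (c2∈ z∈)) (cong₂ _∧₂_ (c1-agree z) (c2-agree z))

    c3-agree : ∀ {z} → All Car₁ z → R₁.c3 z ≡ R₂.c3 z
    c3-agree (_ ∷ [])          = refl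
    c3-agree (a∈ ∷ b∈ ∷ [])    = trans (∼≡∼ _ (B₁.∧∈ a∈ b∈)) (cong ∼₂ (∧≡∧ _ _ a∈ b∈))
    c3-agree (_ ∷ _ ∷ _ ∷ _)   = refl

    tick-agree : ∀ {z} → All Car₁ z → R₁.tick z ≡ R₂.tick z
    tick-agree (_ ∷ [])        = refl
    tick-agree (a∈ ∷ b∈ ∷ [])  = cong₂ (λ x y → x ∷ y ∷ []) (c3-agree (a∈ ∷ b∈ ∷ [])) (∧≡∧ _ _ a∈ b∈)
    tick-agree {_ ∷ _ ∷ c ∷ rest} z∈@(a∈ ∷ b∈ ∷ _ ∷ _) =
      cong₂ (λ x y → c ∷ x ∷ (rest ∷ʳ y)) (∧≡∧ _ _ a∈ b∈)
            (trans (∼≡∼ _ (bigMeet∈ z∈)) (cong ∼₂ (bigMeet-agree z∈)))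

    op-agree : ∀ o {x y} → Car₁ x → Car₁ y → R₁.op o x y ≡ R₂.op o x y
    op-agree and x∈ y∈ = ∧≡∧ _ _ x∈ y∈
    op-agree or  x∈ y∈ = ∨≡∨ _ _ x∈ y∈
    op-agree imp x∈ y∈ = trans (∨≡∨ _ _ (B₁.∼∈ x∈) y∈) (cong (_∨₂ _) (∼≡∼ _ x∈))

    InB-lift : ∀ {z} → R₁.InB z → R₂.InB z
    InB-lift {z} (z∈ , cover) = All.map (λ {x} → ⊆ x) z∈ , λ k → begin
      R₂.meetUpTo z (suc (toℕ k)) ∨₂ lookup z (fsuc k) ≡⟨ cong (_∨₂ _) (sym (meetUpTo-agree z∈ _)) ⟩
      R₁.meetUpTo z (suc (toℕ k)) ∨₂ lookup z (fsuc k) ≡⟨ sym (∨≡∨ _ _ (meetUpTo∈ z∈ _) (lookup⁺ z∈ (fsuc k))) ⟩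
      R₁.meetUpTo z (suc (toℕ k)) ∨₁ lookup z (fsuc k) ≡⟨ cover k ⟩
      𝟙₁                                              ≡⟨ 𝟙≡𝟙 ⟩
      𝟙₂                                              ∎

    InBoo-lift : ∀ {z} → R₁.InBoo z → R₂.InBoo z
    InBoo-lift (zB , c1∧c2≡𝟘) =
      InB-lift zB , trans (sym (c1∧c2-agree (proj₁ zB))) (trans c1∧c2≡𝟘 𝟘≡𝟘)

    InBoo-reflect : ∀ {z} → R₁.InB z → R₂.InBoo z → R₁.InBoo z
    InBoo-reflect zB (_ , c1∧c2≡𝟘) =
      zB , trans (c1∧c2-agree (proj₁ zB)) (trans c1∧c2≡𝟘 (sym 𝟘≡𝟘))

    negM-lift : ∀ {z w} → R₁.InB z → R₁.negM z w → R₂.negM z w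
    negM-lift {z} {w} (z∈ , _) (wB , c1w≡c2z , c2w≤c1z) =
      InB-lift wB , trans (sym (c1-agree w)) (trans c1w≡c2z (c2-agree z)) , (begin
        R₂.c2 w ∧₂ R₂.c1 z ≡⟨ cong₂ _∧₂_ (sym (c2-agree w)) (sym (c1-agree z)) ⟩
        R₁.c2 w ∧₂ R₁.c1 z ≡⟨ sym (∧≡∧ _ _ (c2∈ (proj₁ wB)) (c1∈ z∈)) ⟩
        R₁.c2 w ∧₁ R₁.c1 z ≡⟨ c2w≤c1z ⟩
        R₁.c2 w            ≡⟨ c2-agree w ⟩
        R₂.c2 w            ∎)

    binM-lift : ∀ o {z w u} → R₁.InB z → R₁.InB w → R₁.binM o z w u → R₂.binM o z w u
    binM-lift o {z} {w} {u} zB wB (uB , c1u≡ , boo) =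
      InB-lift uB , c1u≡₂ , λ zBoo wBoo → InBoo-lift (boo (InBoo-reflect zB zBoo) (InBoo-reflect wB wBoo))
      where
      c1u≡₂ : R₂.c1 u ≡ R₂.op o (R₂.c1 z) (R₂.c1 w)
      c1u≡₂ = begin
        R₂.c1 u                        ≡⟨ sym (c1-agree u) ⟩
        R₁.c1 u                        ≡⟨ c1u≡ ⟩
        R₁.op o (R₁.c1 z) (R₁.c1 w)    ≡⟨ op-agree o (c1∈ (proj₁ zB)) (c1∈ (proj₁ wB)) ⟩
        R₂.op o (R₁.c1 z) (R₁.c1 w)    ≡⟨ cong₂ (R₂.op o) (c1-agree z) (c1-agree w) ⟩
        R₂.op o (R₂.c1 z) (R₂.c1 w)    ∎

    InD-lift : ∀ {z} → R₁.InD z → R₂.InD z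
    InD-lift {z} (zB , c1≡𝟙) = InB-lift zB , trans (sym (c1-agree z)) (trans c1≡𝟙 𝟙≡𝟙)

    InF-lift : ∀ {ν} → R₁.InF ν → R₂.InF ν
    InF-lift {ν} ((ν∈B , ν-neg , ν-bin) , ν-c2 , ν-tick , ν-D) =
        ( (λ α → InB-lift (ν∈B α))
        , (λ α → negM-lift (ν∈B α) (ν-neg α))
        , (λ o α β → binM-lift o (ν∈B α) (ν∈B β) (ν-bin o α β)))
      , (λ α → trans (sym (c2-agree (ν (α ∧' ¬' α)))) (trans (ν-c2 α) (c3-agree (proj₁ (ν∈B α)))))
      , (λ α → trans (ν-tick α) (tick-agree (proj₁ (ν∈B α))))
      , (λ o α β → InD-lift (ν-D o α β))

    subRN-lift : SubRN (RMC.RM B₁ n) (RMC.RM B₂ n)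
    subRN-lift = (λ _ → InB-lift)
               , (λ _ zB _ → negM-lift zB)
               , (λ o _ _ zB wB _ → binM-lift o zB wB)
               , (λ _ → InD-lift)
               , (λ _ → InF-lift)

  subalgebra⇒subRN : ∀ {n} → Subalgebra B₁ B₂ → SubRN (RMC.RM B₁ n) (RMC.RM B₂ n)
  subalgebra⇒subRN (⊆ , ∧≡∧ , ∨≡∨ , ∼≡∼ , 𝟘≡𝟘 , 𝟙≡𝟙) = subRN-lift ⊆ ∧≡∧ ∨≡∨ ∼≡∼ 𝟘≡𝟘 𝟙≡𝟙

lemma6p10 : (n : ℕ) → 1 ≤ n → {U : Set} → (B₁ B₂ : BoolAlg U)
    → NonTrivial B₁ → NonTrivial B₂
    → SubRN (RMC.RM B₁ n) (RMC.RM B₂ n) ⇔ Subalgebra B₁ B₂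
lemma6p10 zero    ()
lemma6p10 (suc m) _ _ _ _ _ = mk⇔ subRN⇒subalgebra subalgebra⇒subRN
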